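{- Let $a,k,m\in\mathbb N$ with $1\le k\le a$. Then $$\bigl|\{\alpha<\mathrm{tow}_k(\varepsilon_m):\mathrm{psn}(\alpha)\le a\}\bigr|=\mathrm{tow}_k\bigl(\underbrace{\mathrm{tow}_a(\cdots(\mathrm{tow}_a}_{m+1\text{ times}}(a+1))\cdots)\bigr).$$
   Context: $\varepsilon_{ -1}=\omega$; $\varepsilon_m$ ($m\ge0$) is the $m$-th epsilon number. $\mathrm{tow}_0(x)=1$, $\mathrm{tow}_{n+1}(x)=x^{\mathrm{tow}_n(x)}$, for ordinals and natural numbers alike. $l(\alpha)=\min\{n:\alpha<\varepsilon_n\}$, $h(\alpha)=\min\{n:\alpha<\mathrm{tow}_n(\varepsilon_{l(\alpha)-1})\}$. Normal form: $\alpha=\varepsilon_j^{\alpha_0}\xi_0+\dots+\varepsilon_j^{\alpha_s}\xi_s$ with $j=l(\alpha)-1$, $\alpha_0>\dots>\alpha_s$, $0<\xi_i<\varepsilon_j$. Pseudonorm: $\mathrm{psn}(\alpha)=\alpha$ for $\alpha<\omega$, else $\max\{h(\alpha),\mathrm{psn}(\alpha_i),\mathrm{psn}(\xi_i)\}$. -}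

module Defs where

open import Data.Nat.Base using (ℕ; zero; suc; _^_; _⊔_; _≡ᵇ_; compare; less; equal; greater)
open import Data.Bool.Base using (Bool; true; false; _∧_; not; T; if_then_else_)
open import Data.Product.Base using (Σ; _,_)

-- Ordinal notations for the ordinals below ε_ω.
--
-- Convention: ε_{-1} = ω.  For a level i:
--   O 0       = ℕ                       (the ordinals < ω = ε_{-1})
--   O (suc i) = Cnf (O i)               (the ordinals < ε_i)
-- where an element of O (suc i) is written in base b_i = ε_{i-1}:
--   term e c r  denotes  b_i ^ e · c + r
-- with exponent e : O (suc i) and coefficient c : O i (i.e. c < ε_{i-1}).
-- Well-formed terms (wfO) have strictly decreasing exponents and nonzero
-- coefficients; they represent every ordinal < ε_i exactly once.

data Cnf (C : Set) : Set where
  nil  : Cnf C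
  term : Cnf C → C → Cnf C → Cnf C

O : ℕ → Set
O zero    = ℕ
O (suc i) = Cnf (O i)

data Cmp : Set where
  LT EQ GT : Cmp

thenCmp : Cmp → Cmp → Cmp
thenCmp LT _ = LT
thenCmp EQ o = o
thenCmp GT _ = GT

isLT : Cmp → Bool
isLT LT = true
isLT EQ = false
isLT GT = false

cmpℕ : ℕ → ℕ → Cmp
cmpℕ zero    zero    = EQ
cmpℕ zero    (suc _) = LT
cmpℕ (suc _) zero    = GT
cmpℕ (suc m) (suc n) = cmpℕ m n

cmpO : (i : ℕ) → O i → O i → Cmp
cmpO zero m n = cmpℕ m n
cmpO (suc i) nil          nil          = EQ
cmpO (suc i) nil          (term _ _ _) = LT
cmpO (suc i) (term _ _ _) nil          = GT
cmpO (suc i) (term e c r) (term e′ c′ r′) =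
  thenCmp (cmpO (suc i) e e′) (thenCmp (cmpO i c c′) (cmpO (suc i) r r′))

ltO : (i : ℕ) → O i → O i → Bool
ltO i x y = isLT (cmpO i x y)

isZeroO : (i : ℕ) → O i → Bool
isZeroO zero    n            = n ≡ᵇ 0
isZeroO (suc i) nil          = true
isZeroO (suc i) (term _ _ _) = false

headBelow : (i : ℕ) → O (suc i) → O (suc i) → Bool
headBelow i e nil           = true
headBelow i e (term e′ _ _) = ltO (suc i) e′ e

wfO : (i : ℕ) → O i → Bool
wfO zero    _            = true
wfO (suc i) nil          = true
wfO (suc i) (term e c r) =
  wfO (suc i) e ∧ wfO i c ∧ not (isZeroO i c) ∧ headBelow i e r ∧ wfO (suc i) r

-- canonical level: a level-(suc i) term is canonical iff it is ≥ ε_{i-1},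
-- i.e. its leading exponent is nonzero; then l(α) = i and the stored
-- form is exactly the paper's normal form in base ε_{l(α)-1}.
canon : (i : ℕ) → O i → Bool
canon zero    _                       = true
canon (suc i) nil                     = false
canon (suc i) (term nil _ _)          = false
canon (suc i) (term (term _ _ _) _ _) = true

Ord : Set
Ord = Σ ℕ O

IsOrd : Ord → Set
IsOrd (i , x) = T (wfO i x ∧ canon i x)

cmpOrd : Ord → Ord → Cmp
cmpOrd (i , x) (j , y) with compare i j
cmpOrd (i , x) (j , y)  | less _ _    = LT
cmpOrd (i , x) (.i , y) | equal .i    = cmpO i x y
cmpOrd (i , x) (j , y)  | greater _ _ = GT

_<ₒ_ : Ord → Ord → Set
α <ₒ β = T (isLT (cmpOrd α β))

-- Towers in the notation: towO i n = tow_n(b_{suc i}) = tow_n(ε_{i-1}),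
-- an element of O (suc i).

oneO : (i : ℕ) → O i
oneO zero    = 1
oneO (suc i) = term nil (oneO i) nil

towO : (i : ℕ) → ℕ → O (suc i)
towO i zero    = oneO (suc i)
towO i (suc n) = term (towO i n) (oneO i) nil

-- least n < fuel (searching from start) with p n, or start+fuel if none
search : (ℕ → Bool) → ℕ → ℕ → ℕ
search p n zero    = n
search p n (suc f) = if p n then n else search p (suc n) f

expDepth : {C : Set} → Cnf C → ℕ
expDepth nil          = 0
expDepth (term e _ _) = suc (expDepth e)

-- h(α) = min{ n : α < tow_n(ε_{l(α)-1}) } for α at its canonical level
-- suc i (base ε_{i-1}); the search range 0..expDepth α always contains it.
hgt : (i : ℕ) → O (suc i) → ℕ
hgt i x = search (λ n → ltO (suc i) x (towO i n)) 0 (suc (expDepth x))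

-- Pseudonorm.
--   psn α = α                                   if α < ω
--   psn α = max { h α , psn α_i , psn ξ_i }      otherwise
-- For a level-(suc i) term: nil denotes 0, and `term nil c nil` denotes
-- c < ε_{i-1} itself (so we recurse at the lower level); any other term
-- is ≥ ε_{i-1} and its stored form is the ε_{l(α)-1} normal form.

mutual
  psnO : (i : ℕ) → O i → ℕ
  psnO zero    n                = n
  psnO (suc i) nil              = 0
  psnO (suc i) (term nil c nil) = psnO i c
  psnO (suc i) (term nil c (term e′ c′ r′)) =
    hgt i (term nil c (term e′ c′ r′)) ⊔ partsO i (term nil c (term e′ c′ r′))
  psnO (suc i) (term (term e₁ c₁ r₁) c r) =
    hgt i (term (term e₁ c₁ r₁) c r) ⊔ partsO i (term (term e₁ c₁ r₁) c r)

  partsO : (i : ℕ) → O (suc i) → ℕ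
  partsO i nil          = 0
  partsO i (term e c r) = psnO (suc i) e ⊔ psnO i c ⊔ partsO i r

psn : Ord → ℕ
psn (i , x) = psnO i x

-- tow_k(ε_m): ε_m is the base of level m+2, so tow_k(ε_m) = towO (suc m) k.

towEps : ℕ → ℕ → Ord
towEps k m = (suc (suc m) , towO (suc m) k)

towℕ : ℕ → ℕ → ℕ
towℕ x zero    = 1
towℕ x (suc n) = x ^ towℕ x n

iter : {A : Set} → ℕ → (A → A) → A → A
iter zero    f x = x
iter (suc n) f x = f (iter n f x)

rhs : ℕ → ℕ → ℕ → ℕ
rhs a k m = towℕ (iter (suc m) (λ x → towℕ x a) (suc a)) k

-- The ordinals below ε_ω are given by normal forms in the bases ε_{i-1}
-- (level i+1 of Defs), and the count comes from an explicit enumeration.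
--
-- * psn≤⇒ / psn≤⇐: a notation x of level i+1 has psn x ≤ a iff
--   x < tow_a(ε_{i-1}) and every exponent and coefficient of x has psn ≤ a.
-- * Forms: for a decreasing list D of exponents and a list cs of
--   coefficients, forms D cs lists in decreasing order exactly the normal
--   forms built from them; it has (|cs|+1)^|D| entries.
-- * towList: iterating forms n times from {0} lists the notations below
--   tow_n whose coefficients (at every depth) come from cs; it has
--   tow_n(|cs|+1) entries, and for n ≤ a and cs the coefficients of psn ≤ a
--   it lists exactly the notations below tow_n with psn ≤ a.
-- * coeffs j lists the nonzero level-j notations with psn ≤ a: 1, …, a at
--   level 0 and the nonzero part of towList (n = a) above, so that
--   |coeffs j| + 1 = tow_a(⋯tow_a(a+1)⋯) with j applications of tow_a.
-- * toOrd maps notations of level m+2 (base ε_m) injectively to canonical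
--   ordinals, and every canonical ordinal below tow_k(ε_m) is reached by
--   embedding lower levels; the answer is towList at level m+2 over
--   coeffs (m+1), with tow_k(|coeffs (m+1)| + 1) = rhs a k m elements.

module Submission where

open import Defs
open import Data.Nat.Base using (ℕ; zero; suc; _+_; _*_; _^_; _⊔_; _<_; _≤_; z≤n; s≤s; _≤′_; ≤′-refl; ≤′-step; compare; less; equal; greater)
open import Data.Nat.Properties
open import Data.Product.Base using (Σ; _,_; _×_; ∃; ∃₂; proj₁; proj₂)
open import Data.Product.Properties using (,-injectiveˡ; ,-injectiveʳ-UIP)
open import Data.Empty using (⊥-elim)
open import Data.Bool.Base using (Bool; true; false; not; T)
open import Data.Bool.Properties using (T-∧)
open import Function.Bundles using (_⇔_; mk⇔; Equivalence)
open import Data.List.Relation.Unary.Unique.Propositional using (Unique)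
import Data.List.Relation.Unary.All.Properties as Allₚ
open import Data.Unit.Base using (⊤; tt)
open import Function.Base using (id)
open import Data.List.Base using (List; []; _∷_; _++_; [_]; map; length; cartesianProductWith; applyDownFrom)
open import Data.List.Properties using (length-++; length-map; ++-assoc; length-applyDownFrom)
open import Data.List.Membership.Propositional using (_∈_)
open import Data.List.Membership.Propositional.Properties using (∈-++⁺ˡ; ∈-++⁺ʳ; ∈-++⁻; ∈-map⁺; ∈-map⁻; ∈-cartesianProductWith⁺; ∈-cartesianProductWith⁻; ∈-applyDownFrom⁺; ∈-applyDownFrom⁻)
open import Data.List.Relation.Unary.Any using (here; there)
open import Data.List.Relation.Unary.All as All using (All; []; _∷_)
open import Data.List.Relation.Unary.AllPairs as AllPairs using (AllPairs; []; _∷_)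
import Data.List.Relation.Unary.AllPairs.Properties as AllPairsₚ
open import Data.Sum.Base using (_⊎_; inj₁; inj₂)
open import Relation.Binary.PropositionalEquality hiding ([_])
open import Relation.Nullary using (¬_)
open import Relation.Binary.Definitions using (tri<; tri≈; tri>)

Lt : (i : ℕ) → O i → O i → Set
Lt i x y = cmpO i x y ≡ LT

syntax Lt i x y = x <[ i ] y

LT≢GT : LT ≢ GT
LT≢GT ()

cmpℕ-refl : ∀ n → cmpℕ n n ≡ EQ
cmpℕ-refl zero    = refl
cmpℕ-refl (suc n) = cmpℕ-refl n

cmpℕ-eq : ∀ m n → cmpℕ m n ≡ EQ → m ≡ n
cmpℕ-eq zero    zero    p = refl
cmpℕ-eq (suc m) (suc n) p = cong suc (cmpℕ-eq m n p)

cmpℕ-lt : ∀ m n → cmpℕ m n ≡ LT → m < n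
cmpℕ-lt zero    (suc n) p = s≤s z≤n
cmpℕ-lt (suc m) (suc n) p = s≤s (cmpℕ-lt m n p)

lt-cmpℕ : ∀ m n → m < n → cmpℕ m n ≡ LT
lt-cmpℕ zero    (suc n) p       = refl
lt-cmpℕ (suc m) (suc n) (s≤s p) = lt-cmpℕ m n p

-- A lexicographic combination of transitive comparisons is transitive.
-- p, q, s compare the first components of x/y, y/z, x/z; equal first
-- components make s coincide with the other comparison.
then-trans : ∀ {p q s p′ q′ s′} →
  (p ≡ LT → q ≡ LT → s ≡ LT) → (p ≡ EQ → s ≡ q) → (q ≡ EQ → s ≡ p) →
  (p′ ≡ LT → q′ ≡ LT → s′ ≡ LT) →
  thenCmp p p′ ≡ LT → thenCmp q q′ ≡ LT → thenCmp s s′ ≡ LT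
then-trans {LT} {LT} lt _    _    _    _  _  rewrite lt refl refl = refl
then-trans {LT} {EQ} _  _    eq-q _    _  _  rewrite eq-q refl      = refl
then-trans {EQ} {LT} _  eq-p _    _    _  _  rewrite eq-p refl      = refl
then-trans {EQ} {EQ} _  eq-p _    rest p′ q′ rewrite eq-p refl      = rest p′ q′

cmpO-refl : ∀ i x → cmpO i x x ≡ EQ
cmpO-refl zero    x = cmpℕ-refl x
cmpO-refl (suc i) nil = refl
cmpO-refl (suc i) (term e c r)
  rewrite cmpO-refl (suc i) e | cmpO-refl i c | cmpO-refl (suc i) r = refl

then-EQ : ∀ p q → thenCmp p q ≡ EQ → p ≡ EQ × q ≡ EQ
then-EQ EQ q r = refl , r

then-LT : ∀ p q → thenCmp p q ≡ LT → p ≡ LT ⊎ q ≡ LT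
then-LT LT q _ = inj₁ refl
then-LT EQ q r = inj₂ r

then≢GT : ∀ p {q} → thenCmp p q ≢ GT → p ≢ GT
then≢GT GT h refl = h refl

cmpO-eq : ∀ i x y → cmpO i x y ≡ EQ → x ≡ y
cmpO-eq zero    x   y   p = cmpℕ-eq x y p
cmpO-eq (suc i) nil nil p = refl
cmpO-eq (suc i) (term e c r) (term e′ c′ r′) p
  with then-EQ (cmpO (suc i) e e′) _ p
... | pe , p₁ with then-EQ (cmpO i c c′) (cmpO (suc i) r r′) p₁
... | pc , pr
  with cmpO-eq (suc i) e e′ pe | cmpO-eq i c c′ pc | cmpO-eq (suc i) r r′ pr
... | refl | refl | refl = refl

cmpO-EQˡ : ∀ i x y z → cmpO i x y ≡ EQ → cmpO i x z ≡ cmpO i y z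
cmpO-EQˡ i x y z p = cong (λ w → cmpO i w z) (cmpO-eq i x y p)

cmpO-EQʳ : ∀ i x y z → cmpO i y z ≡ EQ → cmpO i x z ≡ cmpO i x y
cmpO-EQʳ i x y z p = cong (cmpO i x) (sym (cmpO-eq i y z p))

cmpO-trans : ∀ i x y z → x <[ i ] y → y <[ i ] z → x <[ i ] z
cmpO-trans zero x y z p q = lt-cmpℕ x z (<-trans (cmpℕ-lt x y p) (cmpℕ-lt y z q))
cmpO-trans (suc i) nil (term _ _ _) (term _ _ _) p q = refl
cmpO-trans (suc i) (term e₁ c₁ r₁) (term e₂ c₂ r₂) (term e₃ c₃ r₃) =
  then-trans (cmpO-trans (suc i) e₁ e₂ e₃) (cmpO-EQˡ (suc i) e₁ e₂ e₃) (cmpO-EQʳ (suc i) e₁ e₂ e₃)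
    (then-trans (cmpO-trans i c₁ c₂ c₃) (cmpO-EQˡ i c₁ c₂ c₃) (cmpO-EQʳ i c₁ c₂ c₃)
      (cmpO-trans (suc i) r₁ r₂ r₃))
cmpO-trans (suc i) nil          nil          _   ()
cmpO-trans (suc i) (term _ _ _) nil          _   ()
cmpO-trans (suc i) _            (term _ _ _) nil _  ()

cmpO-irrefl : ∀ i x → ¬ x <[ i ] x
cmpO-irrefl i x p with () ← trans (sym (cmpO-refl i x)) p

cmpO-<⇒≢ : ∀ i {x y} → x <[ i ] y → x ≢ y
cmpO-<⇒≢ i {x} p refl = cmpO-irrefl i x p

cmpOrd-level : ∀ i j (x : O i) (y : O j) (e : i ≡ j) →
  cmpOrd (i , x) (j , y) ≡ cmpO j (subst O e x) y
cmpOrd-level i j x y e with compare i j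
cmpOrd-level i .(suc (i + k)) x y e    | less .i k    = ⊥-elim (m≢1+m+n i e)
cmpOrd-level i .i             x y refl | equal .i     = refl
cmpOrd-level .(suc (j + k)) j x y e    | greater .j k = ⊥-elim (m≢1+m+n j (sym e))

cmpOrd-same : ∀ i (x y : O i) → cmpOrd (i , x) (i , y) ≡ cmpO i x y
cmpOrd-same i x y = cmpOrd-level i i x y refl

cmpOrd-less : ∀ i j (x : O i) (y : O j) → i < j → cmpOrd (i , x) (j , y) ≡ LT
cmpOrd-less i j x y p with compare i j
cmpOrd-less i .(suc (i + k)) x y p | less .i k    = refl
cmpOrd-less i .i             x y p | equal .i     = ⊥-elim (<-irrefl refl p)
cmpOrd-less .(suc (j + k)) j x y p | greater .j k = ⊥-elim (<-irrefl refl (<-trans p (s≤s (m≤m+n j k))))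

cmpOrd-greater : ∀ i j (x : O i) (y : O j) → j < i → cmpOrd (i , x) (j , y) ≡ GT
cmpOrd-greater i j x y p with compare i j
cmpOrd-greater i .(suc (i + k)) x y p | less .i k    = ⊥-elim (<-irrefl refl (<-trans p (s≤s (m≤m+n i k))))
cmpOrd-greater i .i             x y p | equal .i     = ⊥-elim (<-irrefl refl p)
cmpOrd-greater .(suc (j + k)) j x y p | greater .j k = refl

record WfTerm (i : ℕ) (e : O (suc i)) (c : O i) (r : O (suc i)) : Set where
  field
    wf-exp   : T (wfO (suc i) e)
    wf-coeff : T (wfO i c)
    coeff≢0  : T (not (isZeroO i c))
    head>    : T (headBelow i e r)
    wf-rest  : T (wfO (suc i) r)

wfTerm⁻ : ∀ i e c r → T (wfO (suc i) (term e c r)) → WfTerm i e c r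
wfTerm⁻ i e c r w =
  let we , wc , nz , hb , wr = unpack w
  in record { wf-exp = we ; wf-coeff = wc ; coeff≢0 = nz ; head> = hb ; wf-rest = wr }
  where
  unpack : T (wfO (suc i) (term e c r)) →
    T (wfO (suc i) e) × T (wfO i c) × T (not (isZeroO i c)) × T (headBelow i e r) × T (wfO (suc i) r)
  unpack _ with wfO (suc i) e | wfO i c | not (isZeroO i c) | headBelow i e r | wfO (suc i) r
  ... | true | true | true | true | true = tt , tt , tt , tt , tt

wfTerm⁺ : ∀ i e c r → WfTerm i e c r → T (wfO (suc i) (term e c r))
wfTerm⁺ i e c r record { wf-exp = we ; wf-coeff = wc ; coeff≢0 = nz ; head> = hb ; wf-rest = wr } =
  pack we wc nz hb wr
  where
  pack : T (wfO (suc i) e) → T (wfO i c) → T (not (isZeroO i c)) → T (headBelow i e r) →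
         T (wfO (suc i) r) → T (wfO (suc i) (term e c r))
  pack _ _ _ _ _ with wfO (suc i) e | wfO i c | not (isZeroO i c) | headBelow i e r | wfO (suc i) r
  ... | true | true | true | true | true = tt

isLT⇒LT : ∀ c → T (isLT c) → c ≡ LT
isLT⇒LT LT _ = refl

LT⇒isLT : ∀ {c} → c ≡ LT → T (isLT c)
LT⇒isLT refl = tt

≮nil : ∀ i r → ¬ r <[ suc i ] nil
≮nil i nil          ()
≮nil i (term _ _ _) ()

¬head>nil : ∀ i e c r → ¬ T (headBelow i nil (term e c r))
¬head>nil i e c r p = ≮nil i e (isLT⇒LT _ p)

≮one : ∀ i c → T (wfO i c) → T (not (isZeroO i c)) → ¬ c <[ i ] oneO i
≮one zero (suc zero)    _ _ ()
≮one zero (suc (suc c)) _ _ ()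
≮one (suc i) (term (term _ _ _) c r) _ _ ()
≮one (suc i) (term nil c r) w _ p with then-LT (cmpO i c (oneO i)) (cmpO (suc i) r nil) p
... | inj₁ c<1 = ≮one i c wf-coeff coeff≢0 c<1
  where open WfTerm (wfTerm⁻ i nil c r w)
... | inj₂ r<0 = ≮nil i r r<0

nil<tow : ∀ i n → nil <[ suc i ] towO i n
nil<tow i zero    = refl
nil<tow i (suc n) = refl

<tow-depth : ∀ i x → x <[ suc i ] towO i (expDepth x)
<tow-depth i nil = refl
<tow-depth i (term e c r) rewrite <tow-depth i e = refl

-- x ≤ tow_n implies x < tow_{n+1}: the leading exponent of x is at most tow_n.
≤tow⇒<tow-suc : ∀ i n x → cmpO (suc i) x (towO i n) ≢ GT → x <[ suc i ] towO i (suc n)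
≤tow⇒<tow-suc i n       nil                      _ = refl
≤tow⇒<tow-suc i zero    (term nil c r)           _ = refl
≤tow⇒<tow-suc i zero    (term (term _ _ _) c r)  h = ⊥-elim (h refl)
≤tow⇒<tow-suc i (suc n) (term e c r) h
  rewrite ≤tow⇒<tow-suc i n e (then≢GT (cmpO (suc i) e (towO i n)) h) = refl

<tow-mono : ∀ i {n n′} x → n ≤ n′ → x <[ suc i ] towO i n → x <[ suc i ] towO i n′
<tow-mono i x n≤n′ = go (≤⇒≤′ n≤n′)
  where
  go : ∀ {n n′} → n ≤′ n′ → x <[ suc i ] towO i n → x <[ suc i ] towO i n′
  go ≤′-refl       x<tow = x<tow
  go (≤′-step {n = m} n≤m) x<tow =
    ≤tow⇒<tow-suc i m x (λ x>tow → LT≢GT (trans (sym (go n≤m x<tow)) x>tow))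

search-≤ : ∀ (p : ℕ → Bool) s f n → s ≤ n → T (p n) → search p s f ≤ n
search-≤ p s zero    n s≤n pn = s≤n
search-≤ p s (suc f) n s≤n pn with p s in ps
... | true  = s≤n
... | false = search-≤ p (suc s) f n (≤∧≢⇒< s≤n s≢n) pn
  where
  s≢n : s ≢ n
  s≢n refl = subst T ps pn

search-sat : ∀ (p : ℕ → Bool) s f n → s ≤ n → n < s + f → T (p n) → T (p (search p s f))
search-sat p s zero n s≤n n<s+0 pn = ⊥-elim (<-irrefl refl (≤-<-trans s≤n (subst (n <_) (+-identityʳ s) n<s+0)))
search-sat p s (suc f) n s≤n n<s+f pn with p s in ps
... | true  = subst T (sym ps) tt
... | false = search-sat p (suc s) f n (≤∧≢⇒< s≤n s≢n) (subst (n <_) (+-suc s f) n<s+f) pn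
  where
  s≢n : s ≢ n
  s≢n refl = subst T ps pn

hgt-≤ : ∀ i x n → x <[ suc i ] towO i n → hgt i x ≤ n
hgt-≤ i x n x<tow = search-≤ _ 0 (suc (expDepth x)) n z≤n (LT⇒isLT x<tow)

hgt-< : ∀ i x n → hgt i x ≤ n → x <[ suc i ] towO i n
hgt-< i x n h≤n = <tow-mono i x h≤n (isLT⇒LT _ found)
  where
  found : T (ltO (suc i) x (towO i (hgt i x)))
  found = search-sat (λ n → ltO (suc i) x (towO i n)) 0 (suc (expDepth x)) (expDepth x)
            z≤n ≤-refl (LT⇒isLT (<tow-depth i x))

psn≤⇒ : ∀ i b x → T (wfO (suc i) x) → psnO (suc i) x ≤ suc b →
        x <[ suc i ] towO i (suc b) × partsO i x ≤ suc b
psn≤⇒ i b nil w p = refl , z≤n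
psn≤⇒ i b (term nil c nil) w p =
  cong (λ o → thenCmp o _) (nil<tow i b) , subst (_≤ suc b) (sym (⊔-identityʳ (psnO i c))) p
psn≤⇒ i b (term nil c (term e′ c′ r′)) w p =
  ⊥-elim (¬head>nil i e′ c′ r′ (WfTerm.head> (wfTerm⁻ i nil c (term e′ c′ r′) w)))
psn≤⇒ i b x@(term (term _ _ _) c r) w p =
  hgt-< i x (suc b) (m⊔n≤o⇒m≤o (hgt i x) _ p) , m⊔n≤o⇒n≤o (hgt i x) _ p

psn≤⇐ : ∀ i b x → T (wfO (suc i) x) → x <[ suc i ] towO i (suc b) → partsO i x ≤ suc b →
        psnO (suc i) x ≤ suc b
psn≤⇐ i b nil w _ _ = z≤n
psn≤⇐ i b (term nil c nil) w _ q = subst (_≤ suc b) (⊔-identityʳ (psnO i c)) q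
psn≤⇐ i b (term nil c (term e′ c′ r′)) w _ _ =
  ⊥-elim (¬head>nil i e′ c′ r′ (WfTerm.head> (wfTerm⁻ i nil c (term e′ c′ r′) w)))
psn≤⇐ i b x@(term (term _ _ _) c r) w p q = ⊔-lub (hgt-≤ i x (suc b) p) q

Every : (i : ℕ) → (O (suc i) → Set) → (O i → Set) → O (suc i) → Set
Every i P Q nil          = ⊤
Every i P Q (term e c r) = P e × Q c × Every i P Q r

Every-map : ∀ i {P P′ Q Q′} → (∀ {e} → P e → P′ e) → (∀ {c} → Q c → Q′ c) →
  ∀ x → Every i P Q x → Every i P′ Q′ x
Every-map i f g nil          _           = tt
Every-map i f g (term e c r) (p , q , ps) = f p , g q , Every-map i f g r ps

Every-map₂ : ∀ i {P P′ P″ Q Q′ Q″} → (∀ {e} → P e → P′ e → P″ e) → (∀ {c} → Q c → Q′ c → Q″ c) →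
  ∀ x → Every i P Q x → Every i P′ Q′ x → Every i P″ Q″ x
Every-map₂ i f g nil          _            _               = tt
Every-map₂ i f g (term e c r) (p , q , ps) (p′ , q′ , ps′) = f p p′ , g q q′ , Every-map₂ i f g r ps ps′

parts≤⇒Every : ∀ i a x → partsO i x ≤ a → Every i (λ e → psnO (suc i) e ≤ a) (λ c → psnO i c ≤ a) x
parts≤⇒Every i a nil          _ = tt
parts≤⇒Every i a (term e c r) p =
  m⊔n≤o⇒m≤o (psnO (suc i) e) _ ec≤a , m⊔n≤o⇒n≤o (psnO (suc i) e) _ ec≤a ,
  parts≤⇒Every i a r (m⊔n≤o⇒n≤o (psnO (suc i) e ⊔ psnO i c) _ p)
  where
  ec≤a : psnO (suc i) e ⊔ psnO i c ≤ a
  ec≤a = m⊔n≤o⇒m≤o (psnO (suc i) e ⊔ psnO i c) _ p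

Every⇒parts≤ : ∀ i a x → Every i (λ e → psnO (suc i) e ≤ a) (λ c → psnO i c ≤ a) x → partsO i x ≤ a
Every⇒parts≤ i a nil          _            = z≤n
Every⇒parts≤ i a (term e c r) (p , q , ps) = ⊔-lub (⊔-lub p q) (Every⇒parts≤ i a r ps)

wf⇒Every : ∀ i x → T (wfO (suc i) x) →
  Every i (λ e → T (wfO (suc i) e)) (λ c → T (wfO i c) × T (not (isZeroO i c))) x
wf⇒Every i nil          _ = tt
wf⇒Every i (term e c r) w = wf-exp , (wf-coeff , coeff≢0) , wf⇒Every i r wf-rest
  where open WfTerm (wfTerm⁻ i e c r w)

-- Exponents of a well-formed notation decrease, so all of them lie below
-- any t that bounds the leading one.
exps< : ∀ i t x → T (wfO (suc i) x) → T (headBelow i t x) → Every i (λ h → h <[ suc i ] t) (λ _ → ⊤) x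
exps< i t nil          _ _  = tt
exps< i t (term h c r) w hb =
  h<t , tt , Every-map i (λ {h′} h′<h → cmpO-trans (suc i) h′ h t h′<h h<t) id r (exps< i h r wf-rest head>)
  where
  open WfTerm (wfTerm⁻ i h c r w)
  h<t : h <[ suc i ] t
  h<t = isLT⇒LT _ hb

<ω^⇒head< : ∀ i t x → T (wfO (suc i) x) → x <[ suc i ] term t (oneO i) nil → T (headBelow i t x)
<ω^⇒head< i t nil          _ _ = tt
<ω^⇒head< i t (term e c r) w x<t with then-LT (cmpO (suc i) e t) _ x<t
... | inj₁ e<t = LT⇒isLT e<t
... | inj₂ rest with then-LT (cmpO i c (oneO i)) (cmpO (suc i) r nil) rest
...   | inj₁ c<1 = ⊥-elim (≮one i c wf-coeff coeff≢0 c<1)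
  where open WfTerm (wfTerm⁻ i e c r w)
...   | inj₂ r<0 = ⊥-elim (≮nil i r r<0)

Desc : (i : ℕ) → List (O i) → Set
Desc i = AllPairs (λ x y → y <[ i ] x)

length-cartesianProductWith : {A B C : Set} (f : A → B → C) (xs : List A) (ys : List B) →
  length (cartesianProductWith f xs ys) ≡ length xs * length ys
length-cartesianProductWith f []       ys = refl
length-cartesianProductWith f (x ∷ xs) ys = begin
  length (map (f x) ys ++ cartesianProductWith f xs ys)       ≡⟨ length-++ (map (f x) ys) ⟩
  length (map (f x) ys) + length (cartesianProductWith f xs ys)
    ≡⟨ cong₂ _+_ (length-map (f x) ys) (length-cartesianProductWith f xs ys) ⟩
  length ys + length xs * length ys                           ∎
  where open ≡-Reasoning

-- Enumerating the normal forms at level suc i whose exponents come from a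
-- decreasing list D and whose coefficients come from a list cs: either the
-- leading exponent is the first e of D, or the form only uses the rest of D.
module Forms (i : ℕ) where

  mutual
    forms⁺ : List (O (suc i)) → List (O i) → List (O (suc i))
    forms⁺ []      cs = []
    forms⁺ (e ∷ D) cs = cartesianProductWith (term e) cs (forms D cs) ++ forms⁺ D cs

    forms : List (O (suc i)) → List (O i) → List (O (suc i))
    forms D cs = forms⁺ D cs ++ [ nil ]

  forms⁺-term : ∀ D cs {x} → x ∈ forms⁺ D cs → ∃ λ e → ∃₂ λ c r → x ≡ term e c r × e ∈ D
  forms⁺-term (e ∷ D) cs x∈ with ∈-++⁻ (cartesianProductWith (term e) cs (forms D cs)) x∈
  ... | inj₁ x∈e with ∈-cartesianProductWith⁻ (term e) cs (forms D cs) x∈e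
  ...   | c , r , _ , _ , refl = e , c , r , refl , here refl
  forms⁺-term (e ∷ D) cs x∈ | inj₂ x∈D with forms⁺-term D cs x∈D
  ...   | e′ , c , r , refl , e′∈D = e′ , c , r , refl , there e′∈D

  length-forms : ∀ D cs → length (forms D cs) ≡ suc (length cs) ^ length D
  length-forms []      cs = refl
  length-forms (e ∷ D) cs = begin
    length ((cartesianProductWith (term e) cs (forms D cs) ++ forms⁺ D cs) ++ [ nil ])
      ≡⟨ cong length (++-assoc (cartesianProductWith (term e) cs (forms D cs)) (forms⁺ D cs) [ nil ]) ⟩
    length (cartesianProductWith (term e) cs (forms D cs) ++ forms D cs)
      ≡⟨ length-++ (cartesianProductWith (term e) cs (forms D cs)) ⟩
    length (cartesianProductWith (term e) cs (forms D cs)) + length (forms D cs)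
      ≡⟨ cong (_+ length (forms D cs)) (length-cartesianProductWith (term e) cs (forms D cs)) ⟩
    length cs * length (forms D cs) + length (forms D cs)
      ≡⟨ +-comm (length cs * length (forms D cs)) _ ⟩
    suc (length cs) * length (forms D cs)
      ≡⟨ cong (suc (length cs) *_) (length-forms D cs) ⟩
    suc (length cs) * suc (length cs) ^ length D ∎
    where open ≡-Reasoning

  -- Forms with a fixed leading exponent are decreasing: ordered by coefficient,
  -- then by the rest.
  desc-× : ∀ e A cs → Desc (suc i) A → Desc i cs → Desc (suc i) (cartesianProductWith (term e) cs A)
  desc-× e A []       dA _             = []
  desc-× e A (c ∷ cs) dA (c>cs ∷ dcs) =
    AllPairsₚ.++⁺ (AllPairsₚ.map⁺ (AllPairs.map (λ {x} {y} → same-coeff x y) dA)) (desc-× e A cs dA dcs)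
      (All.tabulate λ x∈ → All.tabulate λ z∈ → smaller-coeff x∈ z∈)
    where
    same-coeff : ∀ x y → y <[ suc i ] x → term e c y <[ suc i ] term e c x
    same-coeff x y y<x rewrite cmpO-refl (suc i) e | cmpO-refl i c = y<x
    smaller-coeff : ∀ {x z} → x ∈ map (term e c) A → z ∈ cartesianProductWith (term e) cs A →
                    z <[ suc i ] x
    smaller-coeff x∈ z∈ with ∈-map⁻ (term e c) x∈ | ∈-cartesianProductWith⁻ (term e) cs A z∈
    ... | _ , _ , refl | c′ , _ , c′∈ , _ , refl
      rewrite cmpO-refl (suc i) e | All.lookup c>cs c′∈ = refl

  -- All forms are decreasing: those led by the largest exponent come first.
  mutual
    desc-forms⁺ : ∀ D cs → Desc (suc i) D → Desc i cs → Desc (suc i) (forms⁺ D cs)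
    desc-forms⁺ []      cs _            _   = []
    desc-forms⁺ (e ∷ D) cs (e>D ∷ dD) dcs =
      AllPairsₚ.++⁺ (desc-× e (forms D cs) cs (desc-forms D cs dD dcs) dcs) (desc-forms⁺ D cs dD dcs)
        (All.tabulate λ x∈ → All.tabulate λ z∈ → smaller-exp x∈ z∈)
      where
      smaller-exp : ∀ {x z} → x ∈ cartesianProductWith (term e) cs (forms D cs) → z ∈ forms⁺ D cs →
                    z <[ suc i ] x
      smaller-exp x∈ z∈ with ∈-cartesianProductWith⁻ (term e) cs (forms D cs) x∈ | forms⁺-term D cs z∈
      ... | _ , _ , _ , _ , refl | _ , _ , _ , refl , e′∈D rewrite All.lookup e>D e′∈D = refl

    desc-forms : ∀ D cs → Desc (suc i) D → Desc i cs → Desc (suc i) (forms D cs)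
    desc-forms D cs dD dcs = AllPairsₚ.++⁺ (desc-forms⁺ D cs dD dcs) ([] ∷ [])
      (All.tabulate λ x∈ → nil< x∈ ∷ [])
      where
      nil< : ∀ {x} → x ∈ forms⁺ D cs → nil <[ suc i ] x
      nil< x∈ with forms⁺-term D cs x∈
      ... | _ , _ , _ , refl , _ = refl

  below-head : ∀ e D {P : O i → Set} y → T (wfO (suc i) y) → T (headBelow i e y) →
    Every i (_∈ e ∷ D) P y → Every i (_∈ D) P y
  below-head e D y w hb y∈ = Every-map₂ i ∈-tail (λ p _ → p) y y∈ (exps< i e y w hb)
    where
    ∈-tail : ∀ {h} → h ∈ e ∷ D → h <[ suc i ] e → h ∈ D
    ∈-tail (here refl) h<e = ⊥-elim (cmpO-irrefl (suc i) e h<e)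
    ∈-tail (there h∈D) _   = h∈D

  forms-complete : ∀ D cs → Desc (suc i) D → ∀ x → T (wfO (suc i) x) →
    Every i (_∈ D) (_∈ cs) x → x ∈ forms D cs
  forms-complete []      cs _ nil _ _ = here refl
  forms-complete (e ∷ D) cs _ nil _ _ = ∈-++⁺ʳ (forms⁺ (e ∷ D) cs) (here refl)
  forms-complete (e ∷ D) cs (_ ∷ dD) (term .e c r) w (here refl , c∈ , r∈) =
    ∈-++⁺ˡ (∈-++⁺ˡ (∈-cartesianProductWith⁺ (term e) c∈ r∈forms))
    where
    open WfTerm (wfTerm⁻ i e c r w)
    r∈forms : r ∈ forms D cs
    r∈forms = forms-complete D cs dD r wf-rest (below-head e D r wf-rest head> r∈)
  forms-complete (e ∷ D) cs (e>D ∷ dD) (term e₀ c r) w x∈@(there e₀∈D , _) =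
    ∈-++⁺ˡ (∈-++⁺ʳ (cartesianProductWith (term e) cs (forms D cs)) (nonzero x∈forms))
    where
    x∈forms : term e₀ c r ∈ forms D cs
    x∈forms = forms-complete D cs dD (term e₀ c r) w
                (below-head e D (term e₀ c r) w (LT⇒isLT (All.lookup e>D e₀∈D)) x∈)
    nonzero : term e₀ c r ∈ forms D cs → term e₀ c r ∈ forms⁺ D cs
    nonzero x∈ with ∈-++⁻ (forms⁺ D cs) x∈
    ... | inj₁ x∈⁺       = x∈⁺
    ... | inj₂ (here ())

  forms-sound : ∀ D cs → All (λ c → T (wfO i c) × T (not (isZeroO i c))) cs →
    Desc (suc i) D → All (λ e → T (wfO (suc i) e)) D → ∀ x → x ∈ forms D cs →
    T (wfO (suc i) x) × Every i (_∈ D) (_∈ cs) x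
  forms-sound [] cs _ _ _ x (here refl) = tt , tt
  forms-sound (e ∷ D) cs wcs (e>D ∷ dD) (we ∷ wD) x x∈ with ∈-++⁻ (forms⁺ (e ∷ D) cs) x∈
  ... | inj₂ (here refl) = tt , tt
  ... | inj₁ x∈⁺ with ∈-++⁻ (cartesianProductWith (term e) cs (forms D cs)) x∈⁺
  ...   | inj₂ x∈D =
    let wx , ex = forms-sound D cs wcs dD wD x (∈-++⁺ˡ x∈D) in wx , Every-map i there id x ex
  ...   | inj₁ x∈e with ∈-cartesianProductWith⁻ (term e) cs (forms D cs) x∈e
  ...     | c , r , c∈ , r∈ , refl =
    let wr , er = forms-sound D cs wcs dD wD r r∈
        wc , c≢0 = All.lookup wcs c∈
    in wfTerm⁺ i e c r (record { wf-exp = we ; wf-coeff = wc ; coeff≢0 = c≢0 ; head> = head< r er ; wf-rest = wr })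
       , here refl , c∈ , Every-map i there id r er
    where
    head< : ∀ y → Every i (_∈ D) (_∈ cs) y → T (headBelow i e y)
    head< nil          _        = tt
    head< (term h _ _) (h∈D , _) = LT⇒isLT (All.lookup e>D h∈D)

open Forms using (forms⁺; forms)

-- towList i cs n lists the notations below tow_n(ε_{i-1}) all of whose
-- coefficients, at every depth of the exponent tower, come from cs: the
-- exponents of such a notation are exactly the entries of towList i cs (n-1).
towList : (i : ℕ) → List (O i) → ℕ → List (O (suc i))
towList i cs zero    = [ nil ]
towList i cs (suc n) = forms i (towList i cs n) cs

length-towList : ∀ i cs n → length (towList i cs n) ≡ towℕ (suc (length cs)) n
length-towList i cs zero    = refl
length-towList i cs (suc n) =
  trans (Forms.length-forms i (towList i cs n) cs) (cong (suc (length cs) ^_) (length-towList i cs n))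

desc-towList : ∀ i cs n → Desc i cs → Desc (suc i) (towList i cs n)
desc-towList i cs zero    _   = [] ∷ []
desc-towList i cs (suc n) dcs = Forms.desc-forms i (towList i cs n) cs (desc-towList i cs n dcs) dcs

module Count (b : ℕ) where

  Admissible : (j : ℕ) → O j → Set
  Admissible j c = T (wfO j c) × T (not (isZeroO j c)) × psnO j c ≤ suc b

  record Enumerates (j : ℕ) (cs : List (O j)) : Set where
    field
      sound    : ∀ {c} → c ∈ cs → Admissible j c
      complete : ∀ c → Admissible j c → c ∈ cs
      desc     : Desc j cs

  Bounded : (j n : ℕ) → O (suc j) → Set
  Bounded j n x = T (wfO (suc j) x) × x <[ suc j ] towO j n × partsO j x ≤ suc b

  module _ {j : ℕ} {cs : List (O j)} (E : Enumerates j cs) where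
    open Enumerates E

    towList-sound : ∀ n → n ≤ suc b → ∀ {x} → x ∈ towList j cs n → Bounded j n x
    towList-sound zero    _   (here refl) = tt , refl , z≤n
    towList-sound (suc n) n<a {x} x∈ =
      wx , below-tow x ex , Every⇒parts≤ j (suc b) x (Every-map j exp-psn coeff-psn x ex)
      where
      IH : ∀ {e} → e ∈ towList j cs n → Bounded j n e
      IH = towList-sound n (≤-trans (n≤1+n n) n<a)
      wcs : All (λ c → T (wfO j c) × T (not (isZeroO j c))) cs
      wcs = All.tabulate λ c∈ → let wc , c≢0 , _ = sound c∈ in wc , c≢0
      wD : All (λ e → T (wfO (suc j) e)) (towList j cs n)
      wD = All.tabulate λ e∈ → proj₁ (IH e∈)
      sx : T (wfO (suc j) x) × Every j (_∈ towList j cs n) (_∈ cs) x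
      sx = Forms.forms-sound j (towList j cs n) cs wcs (desc-towList j cs n desc) wD x x∈
      wx : T (wfO (suc j) x)
      wx = proj₁ sx
      ex : Every j (_∈ towList j cs n) (_∈ cs) x
      ex = proj₂ sx
      below-tow : ∀ y → Every j (_∈ towList j cs n) (_∈ cs) y → y <[ suc j ] towO j (suc n)
      below-tow nil          _        = refl
      below-tow (term e c r) (e∈ , _) rewrite proj₁ (proj₂ (IH e∈)) = refl
      exp-psn : ∀ {e} → e ∈ towList j cs n → psnO (suc j) e ≤ suc b
      exp-psn {e} e∈ = let we , e<tow , pe = IH e∈ in
        psn≤⇐ j b e we (<tow-mono j e (≤-trans (n≤1+n n) n<a) e<tow) pe
      coeff-psn : ∀ {c} → c ∈ cs → psnO j c ≤ suc b
      coeff-psn c∈ = proj₂ (proj₂ (sound c∈))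

    towList-complete : ∀ n → n ≤ suc b → ∀ x → Bounded j n x → x ∈ towList j cs n
    towList-complete zero _ nil _ = here refl
    towList-complete zero _ (term e c r) (w , x<1 , _) =
      ⊥-elim (≮nil j e (isLT⇒LT _ (<ω^⇒head< j nil (term e c r) w x<1)))
    towList-complete (suc n) n<a x (w , x<tow , px) =
      Forms.forms-complete j (towList j cs n) cs (desc-towList j cs n desc) x w
        (Every-map₂ j exp∈ coeff∈ x
          (Every-map₂ j _,_ (λ c-ok _ → c-ok) x (wf⇒Every j x w) (exps< j (towO j n) x w head<))
          (parts≤⇒Every j (suc b) x px))
      where
      head< : T (headBelow j (towO j n) x)
      head< = <ω^⇒head< j (towO j n) x w x<tow
      exp∈ : ∀ {e} → T (wfO (suc j) e) × e <[ suc j ] towO j n → psnO (suc j) e ≤ suc b →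
             e ∈ towList j cs n
      exp∈ {e} (we , e<tow) pe =
        towList-complete n (≤-trans (n≤1+n n) n<a) e (we , e<tow , proj₂ (psn≤⇒ j b e we pe))
      coeff∈ : ∀ {c} → T (wfO j c) × T (not (isZeroO j c)) → psnO j c ≤ suc b → c ∈ cs
      coeff∈ (wc , c≢0) pc = complete _ (wc , c≢0 , pc)

  -- The admissible coefficients level by level: 1, …, a at level 0, and at
  -- level suc j the nonzero bounded notations below tow_a(ε_{j-1}), since by
  -- psn≤⇒/psn≤⇐ these are exactly the nonzero notations with psn ≤ a.
  coeffs : (j : ℕ) → List (O j)
  coeffs zero    = applyDownFrom suc (suc b)
  coeffs (suc j) = forms⁺ j (towList j (coeffs j) b) (coeffs j)

  coeffs-enumerates : ∀ j → Enumerates j (coeffs j)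
  coeffs-enumerates zero = record
    { sound    = sound
    ; complete = complete
    ; desc     = AllPairsₚ.applyDownFrom⁺₁ suc (suc b) (λ {m} {n} n<m _ → lt-cmpℕ (suc n) (suc m) (s≤s n<m))
    }
    where
    sound : ∀ {c} → c ∈ coeffs zero → Admissible zero c
    sound c∈ with ∈-applyDownFrom⁻ suc c∈
    ... | _ , n<a , refl = tt , tt , n<a
    complete : ∀ c → Admissible zero c → c ∈ coeffs zero
    complete (suc n) (_ , _ , n<a) = ∈-applyDownFrom⁺ suc n<a
  coeffs-enumerates (suc j) = record
    { sound    = sound
    ; complete = complete
    ; desc     = Forms.desc-forms⁺ j D cs (desc-towList j cs b desc) desc
    }
    where
    E : Enumerates j (coeffs j)
    E = coeffs-enumerates j
    open Enumerates E using (desc)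
    cs : List (O j)
    cs = coeffs j
    D : List (O (suc j))
    D = towList j cs b
    sound : ∀ {c} → c ∈ coeffs (suc j) → Admissible (suc j) c
    sound {c} c∈ with towList-sound E (suc b) ≤-refl (∈-++⁺ˡ c∈) | Forms.forms⁺-term j D cs c∈
    ... | wc , c<tow , pc | _ , _ , _ , refl , _ = wc , tt , psn≤⇐ j b c wc c<tow pc
    complete : ∀ c → Admissible (suc j) c → c ∈ coeffs (suc j)
    complete c (wc , c≢0 , pc)
      with ∈-++⁻ (forms⁺ j D cs) (towList-complete E (suc b) ≤-refl c (wc , psn≤⇒ j b c wc pc))
    ... | inj₁ c∈ = c∈
    complete nil (_ , () , _) | inj₂ (here refl)

  length-coeffs : ∀ j → suc (length (coeffs j)) ≡ iter j (λ x → towℕ x (suc b)) (suc (suc b))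
  length-coeffs zero    = cong suc (length-applyDownFrom suc (suc b))
  length-coeffs (suc j) = begin
    suc (length (forms⁺ j D cs))       ≡⟨ +-comm 1 (length (forms⁺ j D cs)) ⟩
    length (forms⁺ j D cs) + 1         ≡⟨ length-++ (forms⁺ j D cs) ⟨
    length (towList j cs (suc b))      ≡⟨ length-towList j cs (suc b) ⟩
    towℕ (suc (length cs)) (suc b)     ≡⟨ cong (λ z → towℕ z (suc b)) (length-coeffs j) ⟩
    iter (suc j) (λ x → towℕ x (suc b)) (suc (suc b)) ∎
    where
    open ≡-Reasoning
    cs : List (O j)
    cs = coeffs j
    D : List (O (suc j))
    D = towList j cs b

-- The ordinal denoted by a level-i notation, at its canonical level: a
-- wrapper term 0 c 0 denotes c itself and is unfolded to the level below.
toOrd : (i : ℕ) → O i → Ord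
toOrd zero    n                            = zero , n
toOrd (suc i) nil                          = zero , zero
toOrd (suc i) (term nil c nil)             = toOrd i c
toOrd (suc i) x@(term nil _ (term _ _ _))  = suc i , x
toOrd (suc i) x@(term (term _ _ _) _ _)    = suc i , x

embed : (i : ℕ) → O i → O (suc i)
embed zero    zero         = nil
embed zero    (suc c)      = term nil (suc c) nil
embed (suc i) nil          = nil
embed (suc i) (term e c r) = term nil (term e c r) nil

toOrd-embed : ∀ i c → toOrd (suc i) (embed i c) ≡ toOrd i c
toOrd-embed zero    zero         = refl
toOrd-embed zero    (suc c)      = refl
toOrd-embed (suc i) nil          = refl
toOrd-embed (suc i) (term e c r) = refl

psn-embed : ∀ i c → psnO (suc i) (embed i c) ≡ psnO i c
psn-embed zero    zero         = refl
psn-embed zero    (suc c)      = refl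
psn-embed (suc i) nil          = refl
psn-embed (suc i) (term e c r) = refl

wf-embed : ∀ i c → T (wfO i c) → T (wfO (suc i) (embed i c))
wf-embed zero    zero         _ = tt
wf-embed zero    (suc c)      _ = tt
wf-embed (suc i) nil          _ = tt
wf-embed (suc i) (term e c r) w = wfTerm⁺ (suc i) nil (term e c r) nil
  (record { wf-exp = tt ; wf-coeff = w ; coeff≢0 = tt ; head> = tt ; wf-rest = tt })

-- Embedded notations are below ε_{i-1} ≤ tow_k(ε_{i-1}) for k ≥ 1.
embed<tow : ∀ i c k → embed i c <[ suc i ] towO i (suc k)
embed<tow zero    zero         k = refl
embed<tow zero    (suc c)      k = cong (λ o → thenCmp o _) (nil<tow zero k)
embed<tow (suc i) nil          k = refl
embed<tow (suc i) (term e c r) k = cong (λ o → thenCmp o _) (nil<tow (suc i) k)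

raise : ∀ {i j} → i ≤′ j → O i → O j
raise ≤′-refl      x = x
raise (≤′-step p)  x = embed _ (raise p x)

toOrd-raise : ∀ {i j} (p : i ≤′ j) x → toOrd j (raise p x) ≡ toOrd i x
toOrd-raise ≤′-refl     x = refl
toOrd-raise (≤′-step p) x = trans (toOrd-embed _ (raise p x)) (toOrd-raise p x)

psn-raise : ∀ {i j} (p : i ≤′ j) x → psnO j (raise p x) ≡ psnO i x
psn-raise ≤′-refl     x = refl
psn-raise (≤′-step p) x = trans (psn-embed _ (raise p x)) (psn-raise p x)

wf-raise : ∀ {i j} (p : i ≤′ j) x → T (wfO i x) → T (wfO j (raise p x))
wf-raise ≤′-refl     x w = w
wf-raise (≤′-step p) x w = wf-embed _ (raise p x) (wf-raise p x w)

psn-toOrd : ∀ i x → psn (toOrd i x) ≡ psnO i x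
psn-toOrd zero    x                          = refl
psn-toOrd (suc i) nil                        = refl
psn-toOrd (suc i) (term nil c nil)           = psn-toOrd i c
psn-toOrd (suc i) (term nil _ (term _ _ _))  = refl
psn-toOrd (suc i) (term (term _ _ _) _ _)    = refl

toOrd-level≤ : ∀ i x → proj₁ (toOrd i x) ≤ i
toOrd-level≤ zero    x                          = ≤-refl
toOrd-level≤ (suc i) nil                        = z≤n
toOrd-level≤ (suc i) (term nil c nil)           = m≤n⇒m≤1+n (toOrd-level≤ i c)
toOrd-level≤ (suc i) (term nil _ (term _ _ _))  = ≤-refl
toOrd-level≤ (suc i) (term (term _ _ _) _ _)    = ≤-refl

toOrd-canon : ∀ i x → T (canon i x) → toOrd i x ≡ (i , x)
toOrd-canon zero    x                       _ = refl
toOrd-canon (suc i) (term (term _ _ _) _ _) _ = refl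

data Shape (i : ℕ) : O (suc i) → Set where
  embedded  : ∀ c → T (wfO i c) → Shape i (embed i c)
  canonical : ∀ x → T (canon (suc i) x) → Shape i x

shape : ∀ i x → T (wfO (suc i) x) → Shape i x
shape zero    nil                           _ = embedded zero tt
shape (suc i) nil                           _ = embedded nil tt
shape zero    (term nil (suc c) nil)        _ = embedded (suc c) tt
shape (suc i) (term nil c@(term _ _ _) nil) w = embedded c (WfTerm.wf-coeff (wfTerm⁻ (suc i) nil c nil w))
shape zero    (term nil zero nil)           w = ⊥-elim (WfTerm.coeff≢0 (wfTerm⁻ zero nil zero nil w))
shape (suc i) (term nil nil nil)            w = ⊥-elim (WfTerm.coeff≢0 (wfTerm⁻ (suc i) nil nil nil w))
shape i       (term nil c (term e c′ r))    w =
  ⊥-elim (¬head>nil i e c′ r (WfTerm.head> (wfTerm⁻ i nil c (term e c′ r) w)))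
shape i       x@(term (term _ _ _) _ _)     _ = canonical x tt

IsOrd-toOrd : ∀ i x → T (wfO i x) → IsOrd (toOrd i x)
IsOrd-toOrd zero    x w = tt
IsOrd-toOrd (suc i) x w with shape i x w
... | embedded c wc  rewrite toOrd-embed i c        = IsOrd-toOrd i c wc
... | canonical x cx rewrite toOrd-canon (suc i) x cx = Equivalence.from (T-∧ {wfO (suc i) x}) (w , cx)

toOrd-level< : ∀ i c y → toOrd i c ≢ (suc i , y)
toOrd-level< i c y eq = 1+n≰n (≤-trans (≤-reflexive (,-injectiveˡ (sym eq))) (toOrd-level≤ i c))

toOrd-injective : ∀ i x y → T (wfO i x) → T (wfO i y) → toOrd i x ≡ toOrd i y → x ≡ y
toOrd-injective zero    x y _  _  refl = refl
toOrd-injective (suc i) x y wx wy eq with shape i x wx | shape i y wy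
... | embedded c wc | embedded c′ wc′ =
  cong (embed i) (toOrd-injective i c c′ wc wc′ (trans (sym (toOrd-embed i c)) (trans eq (toOrd-embed i c′))))
... | embedded c wc | canonical y cy =
  ⊥-elim (toOrd-level< i c y (trans (sym (toOrd-embed i c)) (trans eq (toOrd-canon (suc i) y cy))))
... | canonical x cx | embedded c wc =
  ⊥-elim (toOrd-level< i c x (trans (sym (toOrd-embed i c)) (trans (sym eq) (toOrd-canon (suc i) x cx))))
... | canonical x cx | canonical y cy =
  ,-injectiveʳ-UIP ≡-irrelevant (trans (sym (toOrd-canon (suc i) x cx)) (trans eq (toOrd-canon (suc i) y cy)))

toOrd-unique : ∀ i L → Desc i L → All (λ x → T (wfO i x)) L → Unique (map (toOrd i) L)
toOrd-unique i []      []         []        = []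
toOrd-unique i (x ∷ L) (x>L ∷ dL) (wx ∷ wL) =
  Allₚ.map⁺ (All.tabulate λ {y} y∈L eq →
    cmpO-<⇒≢ i (All.lookup x>L y∈L) (sym (toOrd-injective i x y wx (All.lookup wL y∈L) eq)))
  ∷ toOrd-unique i L dL wL

toOrd-< : ∀ i x y → T (wfO i x) → x <[ i ] y → toOrd i x <ₒ (i , y)
toOrd-< zero x y _ x<y rewrite cmpOrd-same zero x y | x<y = tt
toOrd-< (suc i) x y w x<y with shape i x w
... | embedded c _ rewrite toOrd-embed i c
  | cmpOrd-less (proj₁ (toOrd i c)) (suc i) (proj₂ (toOrd i c)) y (s≤s (toOrd-level≤ i c)) = tt
... | canonical x cx rewrite toOrd-canon (suc i) x cx | cmpOrd-same (suc i) x y | x<y = tt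

notation-below : ∀ m k i x → IsOrd (i , x) → (i , x) <ₒ towEps (suc k) m →
  ∃ λ y → T (wfO (suc (suc m)) y) × y <[ suc (suc m) ] towO (suc m) (suc k)
        × toOrd (suc (suc m)) y ≡ (i , x) × psnO (suc (suc m)) y ≡ psnO i x
notation-below m k i x ox x<tow with Equivalence.to (T-∧ {wfO i x}) ox | <-cmp i (suc (suc m))
... | wx , cx | tri< i<T _ _ =
  embed (suc m) (raise p x) , wf-embed (suc m) (raise p x) (wf-raise p x wx) , embed<tow (suc m) (raise p x) k ,
  trans (toOrd-embed (suc m) (raise p x)) (trans (toOrd-raise p x) (toOrd-canon i x cx)) ,
  trans (psn-embed (suc m) (raise p x)) (psn-raise p x)
  where
  p : i ≤′ suc m
  p = ≤⇒≤′ (≤-pred i<T)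
... | wx , cx | tri≈ _ refl _ =
  x , wx , trans (sym (cmpOrd-same (suc (suc m)) x (towO (suc m) (suc k)))) (isLT⇒LT _ x<tow) ,
  toOrd-canon (suc (suc m)) x cx , refl
... | _ | tri> _ _ T<i =
  ⊥-elim (LT≢GT (trans (sym (isLT⇒LT _ x<tow)) (cmpOrd-greater i (suc (suc m)) x (towO (suc m) (suc k)) T<i)))

module Answer (b m : ℕ) where
  open Count b

  answer : ℕ → List Ord
  answer k = map (toOrd (suc (suc m))) (towList (suc m) (coeffs (suc m)) k)

  answer-sound : ∀ k → k ≤ suc b → ∀ α → α ∈ answer k → IsOrd α × α <ₒ towEps k m × psn α ≤ suc b
  answer-sound k k≤a α α∈ with ∈-map⁻ (toOrd (suc (suc m))) α∈
  ... | x , x∈ , refl with towList-sound (coeffs-enumerates (suc m)) k k≤a x∈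
  ...   | wx , x<tow , px =
    IsOrd-toOrd (suc (suc m)) x wx , toOrd-< (suc (suc m)) x _ wx x<tow ,
    subst (_≤ suc b) (sym (psn-toOrd (suc (suc m)) x))
      (psn≤⇐ (suc m) b x wx (<tow-mono (suc m) x k≤a x<tow) px)

  answer-complete : ∀ k → k < suc b → ∀ α → IsOrd α × α <ₒ towEps (suc k) m × psn α ≤ suc b →
    α ∈ answer (suc k)
  answer-complete k k<a (i , x) (ox , x<tow , px) with notation-below m k i x ox x<tow
  ... | y , wy , y<tow , y↦x , psn-y =
    subst (_∈ answer (suc k)) y↦x (∈-map⁺ (toOrd (suc (suc m)))
      (towList-complete (coeffs-enumerates (suc m)) (suc k) k<a y
        (wy , y<tow , proj₂ (psn≤⇒ (suc m) b y wy (subst (_≤ suc b) (sym psn-y) px)))))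

  answer-unique : ∀ k → k ≤ suc b → Unique (answer k)
  answer-unique k k≤a = toOrd-unique (suc (suc m)) (towList (suc m) (coeffs (suc m)) k)
    (desc-towList (suc m) (coeffs (suc m)) k (Enumerates.desc (coeffs-enumerates (suc m))))
    (All.tabulate λ x∈ → proj₁ (towList-sound (coeffs-enumerates (suc m)) k k≤a x∈))

  answer-length : ∀ k → length (answer k) ≡ rhs (suc b) k m
  answer-length k = begin
    length (answer k)                                     ≡⟨ length-map (toOrd (suc (suc m))) (towList (suc m) (coeffs (suc m)) k) ⟩
    length (towList (suc m) (coeffs (suc m)) k)           ≡⟨ length-towList (suc m) (coeffs (suc m)) k ⟩
    towℕ (suc (length (coeffs (suc m)))) k                ≡⟨ cong (λ z → towℕ z k) (length-coeffs (suc m)) ⟩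
    rhs (suc b) k m                                       ∎
    where open ≡-Reasoning

mainTheorem7 : (a k m : ℕ) → 1 ≤ k → k ≤ a →
    Σ (List Ord) (λ xs → Unique xs
    × ((α : Ord) → (α ∈ xs ⇔ (IsOrd α × α <ₒ towEps k m × psn α ≤ a)))
    × length xs ≡ rhs a k m)
mainTheorem7 (suc b) (suc k) m _ k<a =
  answer (suc k) , answer-unique (suc k) k<a ,
  (λ α → mk⇔ (answer-sound (suc k) k<a α) (answer-complete k k<a α)) , answer-length (suc k)
  where open Answer b m
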